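{- Let $\mathsf V$ be a variety of FL${}_{\mathrm e}$-algebras and let $x{\Rightarrow} y:=(x\to y)\wedge(y\to\neg\neg x)$. Then $(\mathsf V,{\Rightarrow})$ is proto-connexive (equivalently, $\mathsf V$ satisfies any one of the identities $1\leq (x{\Rightarrow} y){\Rightarrow}\neg(x{\Rightarrow}\neg y)$, $1\leq (x{\Rightarrow}\neg y){\Rightarrow}\neg(x{\Rightarrow} y)$, $\neg\neg(x{\Rightarrow} y)\approx\neg(x{\Rightarrow}\neg y)$) if and only if $\mathsf V\subseteq\mathbf G_{\mathsf{FL}_{\mathsf e}}(\mathsf{BA})$. Consequently, $\mathbf G_{\mathsf{FL}_{\mathsf e}}(\mathsf{BA})$ is the largest variety of FL${}_{\mathrm e}$-algebras for which ${\Rightarrow}$ is proto-connexive.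
   Context: An FL${}_{\mathrm e}$-algebra is an algebra $\langle A,\wedge,\vee,\cdot,\to,0,1\rangle$ such that $\langle A,\wedge,\vee\rangle$ is a lattice (with order $\leq$), $\langle A,\cdot,1\rangle$ is a commutative monoid, $0$ is an arbitrary constant, and $x\cdot y\leq z\iff x\leq y\to z$. Write $\neg x:=x\to 0$. For a binary operation ${\Rightarrow}$ on $A$, $(\mathbf A,{\Rightarrow})$ is proto-connexive if for all $x,y$: $1\leq\neg(x{\Rightarrow}\neg x)$, $1\leq\neg(\neg x{\Rightarrow} x)$, $1\leq (x{\Rightarrow} y){\Rightarrow}\neg(x{\Rightarrow}\neg y)$, $1\leq (x{\Rightarrow}\neg y){\Rightarrow}\neg(x{\Rightarrow} y)$; for a variety $\mathsf V$ and term-defined ${\Rightarrow}$, $(\mathsf V,{\Rightarrow})$ is proto-connexive if every member is. $\mathsf{FL}_{\mathsf e}$ is the variety of all FL${}_{\mathrm e}$-algebras; $\mathsf{BA}$ is the variety of Boolean algebras viewed as FL${}_{\mathrm e}$-algebras satisfying $x\cdot y=x\wedge y$ and $x\to y=\neg x\vee y$; $\mathbf G_{\mathsf{FL}_{\mathsf e}}(\mathsf{BA})$ is the largest subvariety $\mathsf W$ of $\mathsf{FL}_{\mathsf e}$ such that for every equation $s\approx t$, $\mathsf{BA}\models s\approx t$ iff $\mathsf W\models\neg s\approx\neg t$. -}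

module Defs where

open import Level using (Level; _⊔_)
open import Data.Nat using (ℕ)
open import Data.Product using (Σ; _×_; _,_)
open import Relation.Binary.PropositionalEquality using (_≡_)

_↔_ : ∀ {a b : Level} → Set a → Set b → Set (a ⊔ b)
P ↔ Q = (P → Q) × (Q → P)

record FLe : Set₁ where
  field
    Carrier : Set
    _∧_ _∨_ _·_ _⇾_ : Carrier → Carrier → Carrier
    𝟘 𝟙 : Carrier
  infixr 7 _∧_ _∨_
  infixr 8 _·_
  infixr 6 _⇾_
  field
    ∧-assoc : ∀ x y z → (x ∧ y) ∧ z ≡ x ∧ (y ∧ z)
    ∨-assoc : ∀ x y z → (x ∨ y) ∨ z ≡ x ∨ (y ∨ z)
    ∧-comm  : ∀ x y → x ∧ y ≡ y ∧ x
    ∨-comm  : ∀ x y → x ∨ y ≡ y ∨ x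
    ∧-absorb : ∀ x y → x ∧ (x ∨ y) ≡ x
    ∨-absorb : ∀ x y → x ∨ (x ∧ y) ≡ x
    ·-assoc : ∀ x y z → (x · y) · z ≡ x · (y · z)
    ·-comm  : ∀ x y → x · y ≡ y · x
    ·-identityˡ : ∀ x → 𝟙 · x ≡ x
  _≤_ : Carrier → Carrier → Set
  x ≤ y = x ∧ y ≡ x
  field
    residuation : ∀ x y z → ((x · y) ≤ z) ↔ (x ≤ (y ⇾ z))
  ¬_ : Carrier → Carrier
  ¬ x = x ⇾ 𝟘

module _ (A : FLe) where
  open FLe A
  ProtoConnexive : (Carrier → Carrier → Carrier) → Set
  ProtoConnexive _⇒_ =
    (∀ x → 𝟙 ≤ (¬ (x ⇒ (¬ x)))) ×
    (∀ x → 𝟙 ≤ (¬ ((¬ x) ⇒ x))) ×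
    (∀ x y → 𝟙 ≤ ((x ⇒ y) ⇒ (¬ (x ⇒ (¬ y))))) ×
    (∀ x y → 𝟙 ≤ ((x ⇒ (¬ y)) ⇒ (¬ (x ⇒ y))))

  cimp : Carrier → Carrier → Carrier
  cimp x y = (x ⇾ y) ∧ (y ⇾ (¬ (¬ x)))

data Term : Set where
  var : ℕ → Term
  _∧ᵗ_ _∨ᵗ_ _·ᵗ_ _⇾ᵗ_ : Term → Term → Term
  0ᵗ 1ᵗ : Term

¬ᵗ_ : Term → Term
¬ᵗ t = t ⇾ᵗ 0ᵗ

⟦_⟧ : Term → (A : FLe) → (ℕ → FLe.Carrier A) → FLe.Carrier A
⟦ var i ⟧ A ρ = ρ i
⟦ s ∧ᵗ t ⟧ A ρ = FLe._∧_ A (⟦ s ⟧ A ρ) (⟦ t ⟧ A ρ)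
⟦ s ∨ᵗ t ⟧ A ρ = FLe._∨_ A (⟦ s ⟧ A ρ) (⟦ t ⟧ A ρ)
⟦ s ·ᵗ t ⟧ A ρ = FLe._·_ A (⟦ s ⟧ A ρ) (⟦ t ⟧ A ρ)
⟦ s ⇾ᵗ t ⟧ A ρ = FLe._⇾_ A (⟦ s ⟧ A ρ) (⟦ t ⟧ A ρ)
⟦ 0ᵗ ⟧ A ρ = FLe.𝟘 A
⟦ 1ᵗ ⟧ A ρ = FLe.𝟙 A

Equation : Set
Equation = Term × Term

_⊨_ : FLe → Equation → Set
A ⊨ (s , t) = ∀ ρ → ⟦ s ⟧ A ρ ≡ ⟦ t ⟧ A ρ

negEq : Equation → Equation
negEq (s , t) = (¬ᵗ s , ¬ᵗ t)

-- A variety of FLe-algebras, presented (Birkhoff) by a set of equations.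
Variety : Set₁
Variety = Equation → Set

_∈_ : FLe → Variety → Set
A ∈ V = ∀ e → V e → A ⊨ e

_⊨ᵛ_ : Variety → Equation → Set₁
V ⊨ᵛ e = ∀ A → A ∈ V → A ⊨ e

_⊆_ : Variety → Variety → Set₁
V ⊆ W = ∀ A → A ∈ V → A ∈ W

IsBA : FLe → Set
IsBA A = ∀ x y →
  (x · y ≡ x ∧ y) × (x ⇾ y ≡ (¬ x) ∨ y) × (𝟘 ≤ x)
  where open FLe A

BA⊨ : Equation → Set₁
BA⊨ e = ∀ A → IsBA A → A ⊨ e

GlivenkoBA : Variety → Set₁
GlivenkoBA W = ∀ e → BA⊨ e ↔ (W ⊨ᵛ negEq e)

-- V ⊆ G_FLe(BA): V is contained in a variety with the Glivenko property
-- (equivalently, in the largest one)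
_⊆G : Variety → Set₁
V ⊆G = Σ Variety λ W → GlivenkoBA W × (V ⊆ W)

PC : Variety → Set₁
PC V = ∀ A → A ∈ V → ProtoConnexive A (cimp A)

Id₁ Id₂ Id₃ : Variety → Set₁
Id₁ V = ∀ A → A ∈ V → ∀ x y →
  let open FLe A in 𝟙 ≤ cimp A (cimp A x y) (¬ (cimp A x (¬ y)))
Id₂ V = ∀ A → A ∈ V → ∀ x y →
  let open FLe A in 𝟙 ≤ cimp A (cimp A x (¬ y)) (¬ (cimp A x y))
Id₃ V = ∀ A → A ∈ V → ∀ x y →
  let open FLe A in ¬ (¬ (cimp A x y)) ≡ ¬ (cimp A x (¬ y))

-- Proto-connexivity and Id₁, Id₂, Id₃ are interchangeable because 𝟙 ≤ a ⇒ ¬ b says exactly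
-- ¬¬ a = ¬ b. Id₃ forces 𝟘 · x ≤ 𝟘, x ≤ ¬¬ (x · x) and 𝟙 ≤ ¬¬ (¬¬ x → x); these make ¬¬ a
-- homomorphism from A onto its regular elements (¬¬ x = x), which form a Boolean algebra, so
-- every Boolean identity s ≈ t gives ¬ s ≈ ¬ t in A. Thus the variety defined by Id₃ has the
-- Glivenko property and contains every V satisfying Id₃. Conversely Id₃ is the negation of the
-- Boolean identity ¬ (x ⇒ y) ≈ x ⇒ ¬ y, so it holds in every variety with the Glivenko property.

module Submission where

open import Defs
open import Algebra.Bundles using (CommutativeSemigroup)
open import Algebra.Core using (Op₂)
open import Algebra.Definitions using (Associative; Commutative)
import Algebra.Properties.CommutativeSemigroup as CommutativeSemigroupProperties
open import Axiom.UniquenessOfIdentityProofs.WithK using (uip)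
open import Data.Nat using (ℕ; zero; suc)
open import Data.Product using (Σ; _×_; _,_; proj₁; proj₂)
open import Function using (_∘_)
open import Relation.Binary.Bundles using (Poset)
open import Relation.Binary.PropositionalEquality
  using (_≡_; refl; sym; trans; cong; cong₂; subst; subst₂; isEquivalence)
import Relation.Binary.Reasoning.PartialOrder as PartialOrderReasoning

commutativeSemigroup : {C : Set} (_∙_ : Op₂ C) →
  Associative _≡_ _∙_ → Commutative _≡_ _∙_ → CommutativeSemigroup _ _
commutativeSemigroup _∙_ assoc comm = record
  { _∙_ = _∙_
  ; isCommutativeSemigroup = record
    { isSemigroup = record
      { isMagma = record { isEquivalence = isEquivalence ; ∙-cong = cong₂ _∙_ }
      ; assoc = assoc }
    ; comm = comm } }

↔-trans : ∀ {a b c} {P : Set a} {Q : Set b} {R : Set c} → P ↔ Q → Q ↔ R → P ↔ R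
↔-trans (P→Q , Q→P) (Q→R , R→Q) = Q→R ∘ P→Q , Q→P ∘ R→Q

↔-sym : ∀ {a b} {P : Set a} {Q : Set b} → P ↔ Q → Q ↔ P
↔-sym (P→Q , Q→P) = Q→P , P→Q

↔-pointwise : ∀ {V : Variety} {P Q : FLe → Set} → (∀ A → P A ↔ Q A) →
  (∀ A → A ∈ V → P A) ↔ (∀ A → A ∈ V → Q A)
↔-pointwise P↔Q = (λ p A A∈V → proj₁ (P↔Q A) (p A A∈V)) , (λ q A A∈V → proj₂ (P↔Q A) (q A A∈V))

valuation₂ : {C : Set} → C → C → ℕ → C
valuation₂ x y zero = x
valuation₂ x y (suc _) = y

module FLeProperties (A : FLe) where
  open FLe A hiding (_≤_) public

  -- FLe._≤_ with a fixity, so that x ∧ y ≤ z needs no parentheses.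
  infix 4 _≤_
  _≤_ : Carrier → Carrier → Set
  x ≤ y = FLe._≤_ A x y

  infix 20 ¬¬_
  ¬¬_ : Carrier → Carrier
  ¬¬ x = ¬ ¬ x

  infixr 5 _⇒_
  _⇒_ : Carrier → Carrier → Carrier
  _⇒_ = cimp A

  module · = CommutativeSemigroupProperties (commutativeSemigroup _·_ ·-assoc ·-comm)
  module ∧ = CommutativeSemigroupProperties (commutativeSemigroup _∧_ ∧-assoc ∧-comm)

  ∧-idem : ∀ x → x ∧ x ≡ x
  ∧-idem x = trans (cong (x ∧_) (sym (∨-absorb x x))) (∧-absorb x (x ∧ x))

  ≤-refl : ∀ {x} → x ≤ x
  ≤-refl {x} = ∧-idem x

  ≤-reflexive : ∀ {x y} → x ≡ y → x ≤ y
  ≤-reflexive refl = ≤-refl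

  ≤-trans : ∀ {x y z} → x ≤ y → y ≤ z → x ≤ z
  ≤-trans {x} {y} {z} x≤y y≤z =
    trans (cong (_∧ z) (sym x≤y)) (trans (∧-assoc x y z) (trans (cong (x ∧_) y≤z) x≤y))

  ≤-antisym : ∀ {x y} → x ≤ y → y ≤ x → x ≡ y
  ≤-antisym {x} {y} x≤y y≤x = trans (sym x≤y) (trans (∧-comm x y) y≤x)

  ≤-poset : Poset _ _ _
  ≤-poset = record
    { isPartialOrder = record
      { isPreorder = record
        { isEquivalence = isEquivalence ; reflexive = ≤-reflexive ; trans = ≤-trans }
      ; antisym = ≤-antisym } }

  module ≤-Reasoning = PartialOrderReasoning ≤-poset

  x∧y≤x : ∀ {x y} → x ∧ y ≤ x
  x∧y≤x {x} {y} = trans (∧-assoc x y x)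
    (trans (cong (x ∧_) (∧-comm y x)) (trans (sym (∧-assoc x x y)) (cong (_∧ y) (∧-idem x))))

  x∧y≤y : ∀ {x y} → x ∧ y ≤ y
  x∧y≤y {x} {y} = trans (∧-assoc x y y) (cong (x ∧_) (∧-idem y))

  ∧-greatest : ∀ {x y z} → z ≤ x → z ≤ y → z ≤ x ∧ y
  ∧-greatest {x} {y} {z} z≤x z≤y = trans (sym (∧-assoc z x y)) (trans (cong (_∧ y) z≤x) z≤y)

  ∧-mono : ∀ {x x′ y y′} → x ≤ x′ → y ≤ y′ → x ∧ y ≤ x′ ∧ y′
  ∧-mono x≤x′ y≤y′ = ∧-greatest (≤-trans x∧y≤x x≤x′) (≤-trans x∧y≤y y≤y′)

  x≤x∨y : ∀ {x y} → x ≤ x ∨ y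
  x≤x∨y {x} {y} = ∧-absorb x y

  y≤x∨y : ∀ {x y} → y ≤ x ∨ y
  y≤x∨y {x} {y} = trans (cong (y ∧_) (∨-comm x y)) (∧-absorb y x)

  ∨-least : ∀ {x y z} → x ≤ z → y ≤ z → x ∨ y ≤ z
  ∨-least {x} {y} {z} x≤z y≤z = trans (cong ((x ∨ y) ∧_) (sym [x∨y]∨z≡z)) (∧-absorb (x ∨ y) z)
    where
    ≤⇒∨≡ : ∀ {u v} → u ≤ v → u ∨ v ≡ v
    ≤⇒∨≡ {u} {v} u≤v = trans (cong (_∨ v) (sym u≤v))
      (trans (∨-comm (u ∧ v) v) (trans (cong (v ∨_) (∧-comm u v)) (∨-absorb v u)))
    [x∨y]∨z≡z : (x ∨ y) ∨ z ≡ z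
    [x∨y]∨z≡z = trans (∨-assoc x y z) (trans (cong (x ∨_) (≤⇒∨≡ y≤z)) (≤⇒∨≡ x≤z))

  ·≤⇒≤⇾ : ∀ {x y z} → x · y ≤ z → x ≤ y ⇾ z
  ·≤⇒≤⇾ {x} {y} {z} = proj₁ (residuation x y z)

  ≤⇾⇒·≤ : ∀ {x y z} → x ≤ y ⇾ z → x · y ≤ z
  ≤⇾⇒·≤ {x} {y} {z} = proj₂ (residuation x y z)

  ·-identityʳ : ∀ x → x · 𝟙 ≡ x
  ·-identityʳ x = trans (·-comm x 𝟙) (·-identityˡ x)

  modus-ponens : ∀ x y → (x ⇾ y) · x ≤ y
  modus-ponens x y = ≤⇾⇒·≤ ≤-refl

  modus-ponens′ : ∀ x y → x · (x ⇾ y) ≤ y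
  modus-ponens′ x y = subst (_≤ y) (·-comm (x ⇾ y) x) (modus-ponens x y)

  ·-monoˡ : ∀ {x x′ y} → x ≤ x′ → x · y ≤ x′ · y
  ·-monoˡ x≤x′ = ≤⇾⇒·≤ (≤-trans x≤x′ (·≤⇒≤⇾ ≤-refl))

  ·-monoʳ : ∀ {x y y′} → y ≤ y′ → x · y ≤ x · y′
  ·-monoʳ {x} {y} {y′} y≤y′ = subst₂ _≤_ (·-comm y x) (·-comm y′ x) (·-monoˡ y≤y′)

  ·-mono : ∀ {x x′ y y′} → x ≤ x′ → y ≤ y′ → x · y ≤ x′ · y′
  ·-mono x≤x′ y≤y′ = ≤-trans (·-monoˡ x≤x′) (·-monoʳ y≤y′)

  ⇾-monoʳ : ∀ {x y y′} → y ≤ y′ → x ⇾ y ≤ x ⇾ y′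
  ⇾-monoʳ {x} {y} y≤y′ = ·≤⇒≤⇾ (≤-trans (modus-ponens x y) y≤y′)

  ⇾-antimonoˡ : ∀ {x x′ y} → x′ ≤ x → x ⇾ y ≤ x′ ⇾ y
  ⇾-antimonoˡ {x} {y = y} x′≤x = ·≤⇒≤⇾ (≤-trans (·-monoʳ x′≤x) (modus-ponens x y))

  ¬-antimono : ∀ {x y} → x ≤ y → ¬ y ≤ ¬ x
  ¬-antimono = ⇾-antimonoˡ

  ≤⇒𝟙≤⇾ : ∀ {x y} → x ≤ y → 𝟙 ≤ x ⇾ y
  ≤⇒𝟙≤⇾ {x} {y} x≤y = ·≤⇒≤⇾ (subst (_≤ y) (sym (·-identityˡ x)) x≤y)

  𝟙≤⇾⇒≤ : ∀ {x y} → 𝟙 ≤ x ⇾ y → x ≤ y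
  𝟙≤⇾⇒≤ {x} {y} 𝟙≤x⇾y = subst (_≤ y) (·-identityˡ x) (≤⇾⇒·≤ 𝟙≤x⇾y)

  𝟙⇾x≤x : ∀ {x} → 𝟙 ⇾ x ≤ x
  𝟙⇾x≤x {x} = subst (_≤ x) (·-identityʳ (𝟙 ⇾ x)) (modus-ponens 𝟙 x)

  ¬𝟙≡𝟘 : ¬ 𝟙 ≡ 𝟘
  ¬𝟙≡𝟘 = ≤-antisym 𝟙⇾x≤x (·≤⇒≤⇾ (≤-reflexive (·-identityʳ 𝟘)))

  ≤¬-swap : ∀ {x y} → x ≤ ¬ y → y ≤ ¬ x
  ≤¬-swap {x} {y} x≤¬y = ·≤⇒≤⇾ (subst (_≤ 𝟘) (·-comm x y) (≤⇾⇒·≤ x≤¬y))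

  x≤¬¬x : ∀ {x} → x ≤ ¬¬ x
  x≤¬¬x = ≤¬-swap ≤-refl

  ¬¬-mono : ∀ {x y} → x ≤ y → ¬¬ x ≤ ¬¬ y
  ¬¬-mono x≤y = ¬-antimono (¬-antimono x≤y)

  ¬¬¬x≡¬x : ∀ {x} → ¬ ¬¬ x ≡ ¬ x
  ¬¬¬x≡¬x = ≤-antisym (¬-antimono x≤¬¬x) x≤¬¬x

  ¬¬¬¬x≡¬¬x : ∀ {x} → ¬¬ ¬¬ x ≡ ¬¬ x
  ¬¬¬¬x≡¬¬x = cong ¬_ ¬¬¬x≡¬x

  ≤¬¬⇒¬¬≤¬¬ : ∀ {x y} → x ≤ ¬¬ y → ¬¬ x ≤ ¬¬ y
  ≤¬¬⇒¬¬≤¬¬ x≤¬¬y = ≤-trans (¬¬-mono x≤¬¬y) (≤-reflexive ¬¬¬¬x≡¬¬x)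

  ⇾¬≡¬· : ∀ {x y} → x ⇾ ¬ y ≡ ¬ (x · y)
  ⇾¬≡¬· {x} {y} = ≤-antisym
    (·≤⇒≤⇾ (begin
      (x ⇾ ¬ y) · (x · y)  ≡⟨ ·-assoc (x ⇾ ¬ y) x y ⟨
      ((x ⇾ ¬ y) · x) · y  ≤⟨ ·-monoˡ (modus-ponens x (¬ y)) ⟩
      ¬ y · y              ≤⟨ modus-ponens y 𝟘 ⟩
      𝟘                    ∎))
    (·≤⇒≤⇾ (·≤⇒≤⇾ (subst (_≤ 𝟘) (sym (·-assoc (¬ (x · y)) x y)) (modus-ponens (x · y) 𝟘))))
    where open ≤-Reasoning

  ¬-∨ : ∀ {x y} → ¬ (x ∨ y) ≡ ¬ x ∧ ¬ y
  ¬-∨ = ≤-antisym (∧-greatest (¬-antimono x≤x∨y) (¬-antimono y≤x∨y))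
                  (≤¬-swap (∨-least (≤¬-swap x∧y≤x) (≤¬-swap x∧y≤y)))

  ·-distribˡ-∨ : ∀ {x y z} → x · (y ∨ z) ≤ x · y ∨ x · z
  ·-distribˡ-∨ {x} {y} {z} = subst (_≤ x · y ∨ x · z) (·-comm (y ∨ z) x)
    (≤⇾⇒·≤ (∨-least (·≤⇒≤⇾ (subst (_≤ x · y ∨ x · z) (·-comm x y) x≤x∨y))
                    (·≤⇒≤⇾ (subst (_≤ x · y ∨ x · z) (·-comm x z) y≤x∨y))))

  ¬¬x·¬¬y≤¬¬[x·y] : ∀ {x y} → ¬¬ x · ¬¬ y ≤ ¬¬ (x · y)
  ¬¬x·¬¬y≤¬¬[x·y] {x} {y} = ·≤⇒≤⇾ (begin
      (¬¬ x · ¬¬ y) · ¬ (x · y)  ≡⟨ ·.xy∙z≈x∙zy (¬¬ x) (¬¬ y) (¬ (x · y)) ⟩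
      ¬¬ x · (¬ (x · y) · ¬¬ y)  ≤⟨ ·-monoʳ (·≤⇒≤⇾ (begin
          (¬ (x · y) · ¬¬ y) · x   ≡⟨ ·.xy∙z≈xz∙y (¬ (x · y)) (¬¬ y) x ⟩
          (¬ (x · y) · x) · ¬¬ y   ≤⟨ ·-monoˡ (≤⇾⇒·≤ (≤-reflexive (sym ⇾¬≡¬·))) ⟩
          ¬ y · ¬¬ y               ≤⟨ modus-ponens′ (¬ y) 𝟘 ⟩
          𝟘                        ∎)) ⟩
      ¬¬ x · ¬ x                 ≤⟨ modus-ponens (¬ x) 𝟘 ⟩
      𝟘                          ∎)
    where open ≤-Reasoning

  ¬≤𝟘⇒≤¬¬· : ∀ {x w} → ¬ w ≤ 𝟘 → x ≤ ¬¬ (x · w)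
  ¬≤𝟘⇒≤¬¬· {x} {w} ¬w≤𝟘 = ·≤⇒≤⇾ (begin
      x · ¬ (x · w)  ≡⟨ cong (x ·_) ⇾¬≡¬· ⟨
      x · (x ⇾ ¬ w)  ≤⟨ modus-ponens′ x (¬ w) ⟩
      ¬ w            ≤⟨ ¬w≤𝟘 ⟩
      𝟘              ∎)
    where open ≤-Reasoning

  𝟙≤⇒ : ∀ {x y} → x ≤ y → y ≤ ¬¬ x → 𝟙 ≤ x ⇒ y
  𝟙≤⇒ x≤y y≤¬¬x = ∧-greatest (≤⇒𝟙≤⇾ x≤y) (≤⇒𝟙≤⇾ y≤¬¬x)

  Regular : Carrier → Set
  Regular x = ¬¬ x ≡ x

  regular-⇾ : ∀ {x y} → Regular y → Regular (x ⇾ y)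
  regular-⇾ {x} {y} ry = subst (λ z → Regular (x ⇾ z)) ry
    (subst Regular (sym ⇾¬≡¬·) ¬¬¬x≡¬x)

  ¬¬-∨-cong : ∀ {x x′ y y′} → ¬ x ≡ ¬ x′ → ¬ y ≡ ¬ y′ → ¬¬ (x ∨ y) ≡ ¬¬ (x′ ∨ y′)
  ¬¬-∨-cong ¬x≡¬x′ ¬y≡¬y′ = cong ¬_ (trans ¬-∨ (trans (cong₂ _∧_ ¬x≡¬x′ ¬y≡¬y′) (sym ¬-∨)))

  𝟙≤x⇒x : ∀ {x} → 𝟙 ≤ x ⇒ x
  𝟙≤x⇒x = 𝟙≤⇒ ≤-refl x≤¬¬x

  𝟙≤⇒¬↔¬¬≡¬ : ∀ {x y} → (𝟙 ≤ x ⇒ ¬ y) ↔ (¬¬ x ≡ ¬ y)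
  𝟙≤⇒¬↔¬¬≡¬ {x} {y} =
    (λ 𝟙≤x⇒¬y → ≤-antisym
      (≤-trans (¬¬-mono (𝟙≤⇾⇒≤ (≤-trans 𝟙≤x⇒¬y x∧y≤x))) (≤-reflexive ¬¬¬x≡¬x))
      (𝟙≤⇾⇒≤ (≤-trans 𝟙≤x⇒¬y x∧y≤y))) ,
    (λ ¬¬x≡¬y → 𝟙≤⇒ (≤-trans x≤¬¬x (≤-reflexive ¬¬x≡¬y)) (≤-reflexive (sym ¬¬x≡¬y)))

  ¬¬≡¬-swap : ∀ {x y} → ¬¬ x ≡ ¬ y → ¬¬ y ≡ ¬ x
  ¬¬≡¬-swap {x} {y} ¬¬x≡¬y = trans (cong ¬_ (sym ¬¬x≡¬y)) ¬¬¬x≡¬x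

  x·y≤¬¬x : ∀ {x y} → 𝟘 · y ≤ 𝟘 → x · y ≤ ¬¬ x
  x·y≤¬¬x {x} {y} 𝟘·y≤𝟘 = ·≤⇒≤⇾ (begin
      (x · y) · ¬ x  ≡⟨ ·.xy∙z≈xz∙y x y (¬ x) ⟩
      (x · ¬ x) · y  ≤⟨ ·-monoˡ (modus-ponens′ x 𝟘) ⟩
      𝟘 · y          ≤⟨ 𝟘·y≤𝟘 ⟩
      𝟘              ∎)
    where open ≤-Reasoning

module ConnexiveIdentities (A : FLe) where
  open FLeProperties A

  Id₁ᴬ Id₂ᴬ Id₃ᴬ : Set
  Id₁ᴬ = ∀ x y → 𝟙 ≤ (x ⇒ y) ⇒ ¬ (x ⇒ ¬ y)
  Id₂ᴬ = ∀ x y → 𝟙 ≤ (x ⇒ ¬ y) ⇒ ¬ (x ⇒ y)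
  Id₃ᴬ = ∀ x y → ¬¬ (x ⇒ y) ≡ ¬ (x ⇒ ¬ y)

  Id₁ᴬ↔Id₃ᴬ : Id₁ᴬ ↔ Id₃ᴬ
  Id₁ᴬ↔Id₃ᴬ = (λ id₁ x y → proj₁ 𝟙≤⇒¬↔¬¬≡¬ (id₁ x y)) ,
              (λ id₃ x y → proj₂ 𝟙≤⇒¬↔¬¬≡¬ (id₃ x y))

  Id₂ᴬ↔Id₃ᴬ : Id₂ᴬ ↔ Id₃ᴬ
  Id₂ᴬ↔Id₃ᴬ = (λ id₂ x y → ¬¬≡¬-swap (proj₁ 𝟙≤⇒¬↔¬¬≡¬ (id₂ x y))) ,
              (λ id₃ x y → proj₂ 𝟙≤⇒¬↔¬¬≡¬ (¬¬≡¬-swap (id₃ x y)))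

  protoConnexive↔Id₃ᴬ : ProtoConnexive A _⇒_ ↔ Id₃ᴬ
  protoConnexive↔Id₃ᴬ =
    (λ (_ , _ , id₁ , _) → proj₁ Id₁ᴬ↔Id₃ᴬ id₁) ,
    (λ id₃ → (λ x → ≤-trans 𝟙≤x⇒x (≤-trans x≤¬¬x (≤-reflexive (id₃ x x)))) ,
             (λ x → ≤-trans 𝟙≤x⇒x (≤-trans x≤¬¬x (≤-reflexive (¬¬≡¬-swap (id₃ (¬ x) x))))) ,
             proj₂ Id₁ᴬ↔Id₃ᴬ id₃ ,
             proj₂ Id₂ᴬ↔Id₃ᴬ id₃)

record GlivenkoAxioms (A : FLe) : Set where
  open FLeProperties A
  field
    𝟘·x≤𝟘 : ∀ x → 𝟘 · x ≤ 𝟘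
    x≤¬¬[x·x] : ∀ x → x ≤ ¬¬ (x · x)
    𝟙≤¬¬[¬¬x⇾x] : ∀ x → 𝟙 ≤ ¬¬ (¬¬ x ⇾ x)

module Id₃Consequences (A : FLe) (id₃ : ConnexiveIdentities.Id₃ᴬ A) where
  open FLeProperties A
  open ConnexiveIdentities A
  open ≤-Reasoning

  x⇒¬x≤𝟘 : ∀ x → x ⇒ ¬ x ≤ 𝟘
  x⇒¬x≤𝟘 x = 𝟙≤⇾⇒≤ (proj₁ (proj₂ protoConnexive↔Id₃ᴬ id₃) x)

  [x·𝟘]·x≤𝟘 : ∀ x → (x · 𝟘) · x ≤ 𝟘
  [x·𝟘]·x≤𝟘 x = begin
      (x · 𝟘) · x              ≤⟨ ·-mono x·𝟘≤¬[𝟙⇒x] x≤¬[𝟙⇒¬x] ⟩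
      ¬ (𝟙 ⇒ x) · ¬ (𝟙 ⇒ ¬ x)  ≡⟨ cong (¬ (𝟙 ⇒ x) ·_) (id₃ 𝟙 x) ⟨
      ¬ (𝟙 ⇒ x) · ¬¬ (𝟙 ⇒ x)   ≤⟨ modus-ponens′ (¬ (𝟙 ⇒ x)) 𝟘 ⟩
      𝟘                        ∎
    where
    x·𝟘≤¬[𝟙⇒x] : x · 𝟘 ≤ ¬ (𝟙 ⇒ x)
    x·𝟘≤¬[𝟙⇒x] = ·≤⇒≤⇾ (begin
        (x · 𝟘) · (𝟙 ⇒ x)       ≤⟨ ·-monoʳ x∧y≤y ⟩
        (x · 𝟘) · (x ⇾ ¬¬ 𝟙)    ≡⟨ ·.xy∙z≈y∙xz x 𝟘 (x ⇾ ¬¬ 𝟙) ⟩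
        𝟘 · (x · (x ⇾ ¬¬ 𝟙))    ≤⟨ ·-monoʳ (modus-ponens′ x (¬¬ 𝟙)) ⟩
        𝟘 · ¬¬ 𝟙                ≡⟨ cong (λ z → 𝟘 · ¬ z) ¬𝟙≡𝟘 ⟩
        𝟘 · ¬ 𝟘                 ≤⟨ modus-ponens′ 𝟘 𝟘 ⟩
        𝟘                       ∎)
    x≤¬[𝟙⇒¬x] : x ≤ ¬ (𝟙 ⇒ ¬ x)
    x≤¬[𝟙⇒¬x] = ·≤⇒≤⇾ (begin
        x · (𝟙 ⇒ ¬ x)  ≤⟨ ·-monoʳ (≤-trans x∧y≤x 𝟙⇾x≤x) ⟩
        x · ¬ x        ≤⟨ modus-ponens′ x 𝟘 ⟩
        𝟘              ∎)

  𝟘·x≤𝟘 : ∀ x → 𝟘 · x ≤ 𝟘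
  𝟘·x≤𝟘 x = begin
      𝟘 · x                    ≤⟨ ·-monoʳ x≤x∨y ⟩
      𝟘 · (x ∨ 𝟙)              ≡⟨ ·-identityʳ _ ⟨
      (𝟘 · (x ∨ 𝟙)) · 𝟙        ≤⟨ ·-monoʳ y≤x∨y ⟩
      (𝟘 · (x ∨ 𝟙)) · (x ∨ 𝟙)  ≡⟨ cong (_· (x ∨ 𝟙)) (·-comm 𝟘 (x ∨ 𝟙)) ⟩
      ((x ∨ 𝟙) · 𝟘) · (x ∨ 𝟙)  ≤⟨ [x·𝟘]·x≤𝟘 (x ∨ 𝟙) ⟩
      𝟘                        ∎

  -- u is chosen so that ¬ u is x ⇒ ¬ x, which Id₃ puts below 𝟘.
  x≤¬¬[x·x] : ∀ x → x ≤ ¬¬ (x · x)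
  x≤¬¬[x·x] x = ≤-trans (¬≤𝟘⇒≤¬¬· ¬u≤𝟘) (≤¬¬⇒¬¬≤¬¬ x·u≤¬¬[x·x])
    where
    u = x · x ∨ ¬ x · ¬ x
    ¬u≤𝟘 : ¬ u ≤ 𝟘
    ¬u≤𝟘 = begin
        ¬ u                        ≡⟨ ¬-∨ ⟩
        ¬ (x · x) ∧ ¬ (¬ x · ¬ x)  ≡⟨ cong₂ _∧_ ⇾¬≡¬· ⇾¬≡¬· ⟨
        x ⇒ ¬ x                    ≤⟨ x⇒¬x≤𝟘 x ⟩
        𝟘                          ∎
    x·[x·x]≤¬¬[x·x] : x · (x · x) ≤ ¬¬ (x · x)
    x·[x·x]≤¬¬[x·x] = begin
        x · (x · x)  ≡⟨ ·-comm x (x · x) ⟩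
        (x · x) · x  ≤⟨ x·y≤¬¬x (𝟘·x≤𝟘 x) ⟩
        ¬¬ (x · x)   ∎
    x·[¬x·¬x]≤¬¬[x·x] : x · (¬ x · ¬ x) ≤ ¬¬ (x · x)
    x·[¬x·¬x]≤¬¬[x·x] = begin
        x · (¬ x · ¬ x)  ≡⟨ ·-assoc x (¬ x) (¬ x) ⟨
        (x · ¬ x) · ¬ x  ≤⟨ ·-monoˡ (modus-ponens′ x 𝟘) ⟩
        𝟘 · ¬ x          ≤⟨ 𝟘·x≤𝟘 (¬ x) ⟩
        𝟘                ≤⟨ ·≤⇒≤⇾ (𝟘·x≤𝟘 (¬ (x · x))) ⟩
        ¬¬ (x · x)       ∎
    x·u≤¬¬[x·x] : x · u ≤ ¬¬ (x · x)
    x·u≤¬¬[x·x] = ≤-trans ·-distribˡ-∨ (∨-least x·[x·x]≤¬¬[x·x] x·[¬x·¬x]≤¬¬[x·x])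

  ¬[x⇒¬¬y]≡¬[x⇒y] : ∀ x y → ¬ (x ⇒ ¬¬ y) ≡ ¬ (x ⇒ y)
  ¬[x⇒¬¬y]≡¬[x⇒y] x y = begin-equality
      ¬ (x ⇒ ¬¬ y)   ≡⟨ id₃ x (¬ y) ⟨
      ¬¬ (x ⇒ ¬ y)   ≡⟨ cong ¬_ (id₃ x y) ⟨
      ¬ ¬¬ (x ⇒ y)   ≡⟨ ¬¬¬x≡¬x ⟩
      ¬ (x ⇒ y)      ∎

  𝟙≤¬¬[¬¬x⇾x] : ∀ x → 𝟙 ≤ ¬¬ (¬¬ x ⇾ x)
  𝟙≤¬¬[¬¬x⇾x] x = ≤⇒𝟙≤⇾ (begin
      ¬ (¬¬ x ⇾ x)      ≤⟨ ¬-antimono x∧y≤x ⟩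
      ¬ (¬¬ x ⇒ x)      ≡⟨ ¬[x⇒¬¬y]≡¬[x⇒y] (¬¬ x) x ⟨
      ¬ (¬¬ x ⇒ ¬¬ x)   ≤⟨ ¬-antimono 𝟙≤x⇒x ⟩
      ¬ 𝟙               ≡⟨ ¬𝟙≡𝟘 ⟩
      𝟘                 ∎)

  glivenkoAxioms : GlivenkoAxioms A
  glivenkoAxioms = record
    { 𝟘·x≤𝟘 = 𝟘·x≤𝟘 ; x≤¬¬[x·x] = x≤¬¬[x·x] ; 𝟙≤¬¬[¬¬x⇾x] = 𝟙≤¬¬[¬¬x⇾x] }

module DoubleNegation (A : FLe) (g : GlivenkoAxioms A) where
  open FLeProperties A
  open GlivenkoAxioms g
  open ≤-Reasoning

  ⊤ : Carrier
  ⊤ = ¬ 𝟘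

  x≤⊤ : ∀ {x} → x ≤ ⊤
  x≤⊤ {x} = ·≤⇒≤⇾ (subst (_≤ 𝟘) (·-comm 𝟘 x) (𝟘·x≤𝟘 x))

  𝟘≤¬x : ∀ {x} → 𝟘 ≤ ¬ x
  𝟘≤¬x {x} = ·≤⇒≤⇾ (𝟘·x≤𝟘 x)

  ¬¬𝟘≡𝟘 : ¬¬ 𝟘 ≡ 𝟘
  ¬¬𝟘≡𝟘 = ≤-antisym (≤-trans (¬-antimono x≤⊤) (≤-reflexive ¬𝟙≡𝟘)) 𝟘≤¬x

  ¬¬[x·y]≡¬¬x∧¬¬y : ∀ {x y} → ¬¬ (x · y) ≡ ¬¬ x ∧ ¬¬ y
  ¬¬[x·y]≡¬¬x∧¬¬y {x} {y} = ≤-antisym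
    (∧-greatest (≤¬¬⇒¬¬≤¬¬ (x·y≤¬¬x (𝟘·x≤𝟘 y)))
                (≤¬¬⇒¬¬≤¬¬ (subst (_≤ ¬¬ y) (·-comm y x) (x·y≤¬¬x (𝟘·x≤𝟘 x)))))
    (begin
      ¬¬ x ∧ ¬¬ y                          ≤⟨ x≤¬¬[x·x] _ ⟩
      ¬¬ ((¬¬ x ∧ ¬¬ y) · (¬¬ x ∧ ¬¬ y))   ≤⟨ ¬¬-mono (·-mono x∧y≤x x∧y≤y) ⟩
      ¬¬ (¬¬ x · ¬¬ y)                     ≤⟨ ≤¬¬⇒¬¬≤¬¬ ¬¬x·¬¬y≤¬¬[x·y] ⟩
      ¬¬ (x · y)                           ∎)

  -- 𝟙 ≤ ¬¬ (¬¬ y ⇾ y) lets y · (¬¬ y ⇾ y) stand in for ¬¬ y.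
  ¬¬y≤¬¬[x⇾y] : ∀ {x y} → ¬¬ y ≤ ¬¬ (x ⇾ y)
  ¬¬y≤¬¬[x⇾y] {x} {y} = ≤¬¬⇒¬¬≤¬¬ (begin
      y                         ≤⟨ ¬≤𝟘⇒≤¬¬· (𝟙≤⇾⇒≤ (𝟙≤¬¬[¬¬x⇾x] y)) ⟩
      ¬¬ (y · (¬¬ y ⇾ y))       ≤⟨ ¬¬-mono (·≤⇒≤⇾ (begin
          (y · (¬¬ y ⇾ y)) · x    ≡⟨ ·.xy∙z≈y∙zx y (¬¬ y ⇾ y) x ⟩
          (¬¬ y ⇾ y) · (x · y)    ≡⟨ cong ((¬¬ y ⇾ y) ·_) (·-comm x y) ⟩
          (¬¬ y ⇾ y) · (y · x)    ≤⟨ ·-monoʳ (x·y≤¬¬x (𝟘·x≤𝟘 x)) ⟩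
          (¬¬ y ⇾ y) · ¬¬ y       ≤⟨ modus-ponens (¬¬ y) y ⟩
          y                       ∎)) ⟩
      ¬¬ (x ⇾ y)                ∎)

  ¬x≤¬¬[x⇾y] : ∀ {x y} → ¬ x ≤ ¬¬ (x ⇾ y)
  ¬x≤¬¬[x⇾y] {x} {y} = begin
      ¬ x                     ≤⟨ ¬≤𝟘⇒≤¬¬· ¬[𝟘⇾y]≤𝟘 ⟩
      ¬¬ (¬ x · (𝟘 ⇾ y))      ≤⟨ ¬¬-mono (·≤⇒≤⇾ (begin
          (¬ x · (𝟘 ⇾ y)) · x   ≡⟨ ·.xy∙z≈z∙xy (¬ x) (𝟘 ⇾ y) x ⟩
          x · (¬ x · (𝟘 ⇾ y))   ≡⟨ ·-assoc x (¬ x) (𝟘 ⇾ y) ⟨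
          (x · ¬ x) · (𝟘 ⇾ y)   ≤⟨ ·-monoˡ (modus-ponens′ x 𝟘) ⟩
          𝟘 · (𝟘 ⇾ y)           ≤⟨ modus-ponens′ 𝟘 y ⟩
          y                     ∎)) ⟩
      ¬¬ (x ⇾ y)              ∎
    where
    ¬[𝟘⇾y]≤𝟘 : ¬ (𝟘 ⇾ y) ≤ 𝟘
    ¬[𝟘⇾y]≤𝟘 = 𝟙≤⇾⇒≤ (≤-trans (𝟙≤¬¬[¬¬x⇾x] y) (¬¬-mono (⇾-antimonoˡ 𝟘≤¬x)))

  ¬¬[x⇾y]≡¬[¬¬x∧¬y] : ∀ {x y} → ¬¬ (x ⇾ y) ≡ ¬ (¬¬ x ∧ ¬ y)
  ¬¬[x⇾y]≡¬[¬¬x∧¬y] {x} {y} = ≤-antisym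
    (≤-trans (¬¬-mono (begin
      x ⇾ y              ≤⟨ ⇾-monoʳ x≤¬¬x ⟩
      x ⇾ ¬¬ y           ≡⟨ ⇾¬≡¬· ⟩
      ¬ (x · ¬ y)        ≡⟨ ¬¬¬x≡¬x ⟨
      ¬ ¬¬ (x · ¬ y)     ≡⟨ cong ¬_ ¬¬[x·y]≡¬¬x∧¬¬y ⟩
      ¬ (¬¬ x ∧ ¬¬ ¬ y)  ≡⟨ cong (λ z → ¬ (¬¬ x ∧ z)) ¬¬¬x≡¬x ⟩
      ¬ (¬¬ x ∧ ¬ y)     ∎)) (≤-reflexive ¬¬¬x≡¬x))
    (¬-antimono (∧-greatest (≤¬-swap ¬x≤¬¬[x⇾y]) (begin
      ¬ (x ⇾ y)       ≡⟨ ¬¬¬x≡¬x ⟨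
      ¬ ¬¬ (x ⇾ y)    ≤⟨ ¬-antimono ¬¬y≤¬¬[x⇾y] ⟩
      ¬ ¬¬ y          ≡⟨ ¬¬¬x≡¬x ⟩
      ¬ y             ∎)))

  -- w = (x ∨ 𝟙) ⇾ 𝟙 lies below 𝟙 and is dense, so x · w ≤ x ∧ 𝟙 without losing ¬¬ x.
  ¬¬x≤¬¬[x∧𝟙] : ∀ {x} → ¬¬ x ≤ ¬¬ (x ∧ 𝟙)
  ¬¬x≤¬¬[x∧𝟙] {x} = ≤¬¬⇒¬¬≤¬¬ (≤-trans (¬≤𝟘⇒≤¬¬· ¬w≤𝟘) (¬¬-mono x·w≤x∧𝟙))
    where
    w = (x ∨ 𝟙) ⇾ 𝟙
    ¬w≤𝟘 : ¬ w ≤ 𝟘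
    ¬w≤𝟘 = 𝟙≤⇾⇒≤ (≤-trans x≤¬¬x ¬¬y≤¬¬[x⇾y])
    x·w≤x∧𝟙 : x · w ≤ x ∧ 𝟙
    x·w≤x∧𝟙 = ∧-greatest
      (≤-trans (·-monoʳ (≤-trans (⇾-antimonoˡ y≤x∨y) 𝟙⇾x≤x)) (≤-reflexive (·-identityʳ x)))
      (≤-trans (·-monoˡ x≤x∨y) (modus-ponens′ (x ∨ 𝟙) 𝟙))

  ¬¬[x∧y]≡¬¬x∧¬¬y : ∀ {x y} → ¬¬ (x ∧ y) ≡ ¬¬ x ∧ ¬¬ y
  ¬¬[x∧y]≡¬¬x∧¬¬y {x} {y} = ≤-antisym (∧-greatest (¬¬-mono x∧y≤x) (¬¬-mono x∧y≤y)) (begin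
      ¬¬ x ∧ ¬¬ y                ≤⟨ ∧-mono ¬¬x≤¬¬[x∧𝟙] ¬¬x≤¬¬[x∧𝟙] ⟩
      ¬¬ (x ∧ 𝟙) ∧ ¬¬ (y ∧ 𝟙)    ≡⟨ ¬¬[x·y]≡¬¬x∧¬¬y ⟨
      ¬¬ ((x ∧ 𝟙) · (y ∧ 𝟙))     ≤⟨ ¬¬-mono (∧-greatest
          (≤-trans (·-mono x∧y≤x x∧y≤y) (≤-reflexive (·-identityʳ x)))
          (≤-trans (·-mono x∧y≤y x∧y≤x) (≤-reflexive (·-identityˡ y)))) ⟩
      ¬¬ (x ∧ y)                 ∎)

  ¬¬[x⇾y]≡¬¬x⇾¬¬y : ∀ {x y} → ¬¬ (x ⇾ y) ≡ ¬¬ x ⇾ ¬¬ y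
  ¬¬[x⇾y]≡¬¬x⇾¬¬y {x} {y} = begin-equality
      ¬¬ (x ⇾ y)           ≡⟨ ¬¬[x⇾y]≡¬[¬¬x∧¬y] ⟩
      ¬ (¬¬ x ∧ ¬ y)       ≡⟨ cong₂ (λ u v → ¬ (u ∧ v)) ¬¬¬¬x≡¬¬x ¬¬¬x≡¬x ⟨
      ¬ (¬¬ ¬¬ x ∧ ¬¬ ¬ y) ≡⟨ cong ¬_ ¬¬[x·y]≡¬¬x∧¬¬y ⟨
      ¬ ¬¬ (¬¬ x · ¬ y)    ≡⟨ ¬¬¬x≡¬x ⟩
      ¬ (¬¬ x · ¬ y)       ≡⟨ ⇾¬≡¬· ⟨
      ¬¬ x ⇾ ¬¬ y          ∎

  regular-∧ : ∀ {x y} → Regular x → Regular y → Regular (x ∧ y)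
  regular-∧ rx ry = trans ¬¬[x∧y]≡¬¬x∧¬¬y (cong₂ _∧_ rx ry)

  ∧≤⇒≤⇾ : ∀ {x y z} → Regular x → Regular y → x ∧ y ≤ z → x ≤ y ⇾ z
  ∧≤⇒≤⇾ {x} {y} rx ry x∧y≤z = ·≤⇒≤⇾ (begin
      x · y        ≤⟨ x≤¬¬x ⟩
      ¬¬ (x · y)   ≡⟨ ¬¬[x·y]≡¬¬x∧¬¬y ⟩
      ¬¬ x ∧ ¬¬ y  ≡⟨ cong₂ _∧_ rx ry ⟩
      x ∧ y        ≤⟨ x∧y≤z ⟩
      _            ∎)

  ≤⇾⇒∧≤ : ∀ {x y z} → Regular z → x ≤ y ⇾ z → x ∧ y ≤ z
  ≤⇾⇒∧≤ {x} {y} {z} rz x≤y⇾z = begin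
      x ∧ y                      ≤⟨ x≤¬¬[x·x] (x ∧ y) ⟩
      ¬¬ ((x ∧ y) · (x ∧ y))     ≤⟨ ¬¬-mono (·-mono x∧y≤x x∧y≤y) ⟩
      ¬¬ (x · y)                 ≤⟨ ¬¬-mono (≤⇾⇒·≤ x≤y⇾z) ⟩
      ¬¬ z                       ≡⟨ rz ⟩
      z                          ∎

module RegularAlgebra (A : FLe) (g : GlivenkoAxioms A) where
  open FLeProperties A
  open DoubleNegation A g

  Reg : Set
  Reg = Σ Carrier Regular

  reg-≡ : ∀ {x y : Reg} → proj₁ x ≡ proj₁ y → x ≡ y
  reg-≡ {x , rx} {.x , ry} refl = cong (x ,_) (uip rx ry)

  infixr 7 _∧ᴿ_ _∨ᴿ_
  infixr 6 _⇾ᴿ_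

  _∧ᴿ_ _∨ᴿ_ _⇾ᴿ_ : Reg → Reg → Reg
  (x , rx) ∧ᴿ (y , ry) = x ∧ y , regular-∧ rx ry
  (x , _) ∨ᴿ (y , _) = ¬¬ (x ∨ y) , ¬¬¬¬x≡¬¬x
  (x , _) ⇾ᴿ (y , ry) = x ⇾ y , regular-⇾ ry

  ∨ᴿ-assoc : ∀ x y z → (x ∨ᴿ y) ∨ᴿ z ≡ x ∨ᴿ (y ∨ᴿ z)
  ∨ᴿ-assoc (x , _) (y , _) (z , _) = reg-≡ (begin-equality
      ¬¬ (¬¬ (x ∨ y) ∨ z)  ≡⟨ ¬¬-∨-cong ¬¬¬x≡¬x refl ⟩
      ¬¬ ((x ∨ y) ∨ z)     ≡⟨ cong ¬¬_ (∨-assoc x y z) ⟩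
      ¬¬ (x ∨ (y ∨ z))     ≡⟨ ¬¬-∨-cong refl ¬¬¬x≡¬x ⟨
      ¬¬ (x ∨ ¬¬ (y ∨ z))  ∎)
    where open ≤-Reasoning

  residuationᴿ : ∀ x y z → (((x ∧ᴿ y) ∧ᴿ z) ≡ x ∧ᴿ y) ↔ (x ∧ᴿ (y ⇾ᴿ z) ≡ x)
  residuationᴿ (x , rx) (y , ry) (z , rz) =
    (λ x∧y≤z → reg-≡ (∧≤⇒≤⇾ rx ry (cong proj₁ x∧y≤z))) ,
    (λ x≤y⇾z → reg-≡ (≤⇾⇒∧≤ rz (cong proj₁ x≤y⇾z)))

  regularAlgebra : FLe
  regularAlgebra = record
    { Carrier = Reg
    ; _∧_ = _∧ᴿ_ ; _∨_ = _∨ᴿ_ ; _·_ = _∧ᴿ_ ; _⇾_ = _⇾ᴿ_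
    ; 𝟘 = 𝟘 , ¬¬𝟘≡𝟘 ; 𝟙 = ⊤ , ¬¬¬x≡¬x
    ; ∧-assoc = λ x y z → reg-≡ (∧-assoc _ _ _)
    ; ∨-assoc = ∨ᴿ-assoc
    ; ∧-comm = λ x y → reg-≡ (∧-comm _ _)
    ; ∨-comm = λ x y → reg-≡ (cong ¬¬_ (∨-comm _ _))
    ; ∧-absorb = λ x y → reg-≡ (≤-trans x≤x∨y x≤¬¬x)
    ; ∨-absorb = λ (x , rx) y → reg-≡ (trans (cong ¬¬_ (∨-absorb x _)) rx)
    ; ·-assoc = λ x y z → reg-≡ (∧-assoc _ _ _)
    ; ·-comm = λ x y → reg-≡ (∧-comm _ _)
    ; ·-identityˡ = λ x → reg-≡ (trans (∧-comm _ _) x≤⊤)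
    ; residuation = residuationᴿ
    }

  regularAlgebra-isBA : IsBA regularAlgebra
  regularAlgebra-isBA (x , rx) (y , ry) = refl , reg-≡ x⇾y≡¬¬[¬x∨y] , reg-≡ 𝟘≤x
    where
    open ≤-Reasoning
    x⇾y≡¬¬[¬x∨y] : x ⇾ y ≡ ¬¬ (¬ x ∨ y)
    x⇾y≡¬¬[¬x∨y] = begin-equality
      x ⇾ y             ≡⟨ regular-⇾ ry ⟨
      ¬¬ (x ⇾ y)        ≡⟨ ¬¬[x⇾y]≡¬[¬¬x∧¬y] ⟩
      ¬ (¬¬ x ∧ ¬ y)    ≡⟨ cong ¬_ ¬-∨ ⟨
      ¬¬ (¬ x ∨ y)      ∎
    𝟘≤x : 𝟘 ≤ x
    𝟘≤x = ≤-trans 𝟘≤¬x (≤-reflexive rx)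

  ¬¬ᴿ : Carrier → Reg
  ¬¬ᴿ x = ¬¬ x , ¬¬¬¬x≡¬¬x

  ⟦⟧-¬¬ : ∀ t ρ → proj₁ (⟦ t ⟧ regularAlgebra (¬¬ᴿ ∘ ρ)) ≡ ¬¬ ⟦ t ⟧ A ρ
  ⟦⟧-¬¬ (var i) ρ = refl
  ⟦⟧-¬¬ (s ∧ᵗ t) ρ = trans (cong₂ _∧_ (⟦⟧-¬¬ s ρ) (⟦⟧-¬¬ t ρ)) (sym ¬¬[x∧y]≡¬¬x∧¬¬y)
  ⟦⟧-¬¬ (s ∨ᵗ t) ρ = ¬¬-∨-cong (trans (cong ¬_ (⟦⟧-¬¬ s ρ)) ¬¬¬x≡¬x)
                                (trans (cong ¬_ (⟦⟧-¬¬ t ρ)) ¬¬¬x≡¬x)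
  ⟦⟧-¬¬ (s ·ᵗ t) ρ = trans (cong₂ _∧_ (⟦⟧-¬¬ s ρ) (⟦⟧-¬¬ t ρ)) (sym ¬¬[x·y]≡¬¬x∧¬¬y)
  ⟦⟧-¬¬ (s ⇾ᵗ t) ρ = trans (cong₂ _⇾_ (⟦⟧-¬¬ s ρ) (⟦⟧-¬¬ t ρ)) (sym ¬¬[x⇾y]≡¬¬x⇾¬¬y)
  ⟦⟧-¬¬ 0ᵗ ρ = sym ¬¬𝟘≡𝟘
  ⟦⟧-¬¬ 1ᵗ ρ = cong ¬_ (sym ¬𝟙≡𝟘)

  glivenko : ∀ {e} → BA⊨ e → A ⊨ negEq e
  glivenko {s , t} valid ρ = begin-equality
      ¬ ⟦ s ⟧ A ρ                                  ≡⟨ ¬¬¬x≡¬x ⟨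
      ¬ ¬¬ ⟦ s ⟧ A ρ                               ≡⟨ cong ¬_ (⟦⟧-¬¬ s ρ) ⟨
      ¬ proj₁ (⟦ s ⟧ regularAlgebra (¬¬ᴿ ∘ ρ))     ≡⟨ cong (¬_ ∘ proj₁) (valid regularAlgebra regularAlgebra-isBA (¬¬ᴿ ∘ ρ)) ⟩
      ¬ proj₁ (⟦ t ⟧ regularAlgebra (¬¬ᴿ ∘ ρ))     ≡⟨ cong ¬_ (⟦⟧-¬¬ t ρ) ⟩
      ¬ ¬¬ ⟦ t ⟧ A ρ                               ≡⟨ ¬¬¬x≡¬x ⟩
      ¬ ⟦ t ⟧ A ρ                                  ∎
    where open ≤-Reasoning

module BooleanAlgebra (A : FLe) (ba : IsBA A) where
  open FLeProperties A
  open ConnexiveIdentities A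
  open ≤-Reasoning

  ·≡∧ : ∀ x y → x · y ≡ x ∧ y
  ·≡∧ x y = proj₁ (ba x y)

  ⇾≡¬∨ : ∀ x y → x ⇾ y ≡ ¬ x ∨ y
  ⇾≡¬∨ x y = proj₁ (proj₂ (ba x y))

  𝟘≤x : ∀ {x} → 𝟘 ≤ x
  𝟘≤x {x} = proj₂ (proj₂ (ba x x))

  ¬¬x≡x : ∀ {x} → ¬¬ x ≡ x
  ¬¬x≡x {x} = ≤-antisym (begin
      ¬¬ x                    ≡⟨ ·-identityʳ (¬¬ x) ⟨
      ¬¬ x · 𝟙                ≤⟨ ·-monoʳ (≤⇒𝟙≤⇾ ≤-refl) ⟩
      ¬¬ x · (x ⇾ x)          ≡⟨ cong (¬¬ x ·_) (⇾≡¬∨ x x) ⟩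
      ¬¬ x · (¬ x ∨ x)        ≤⟨ ·-distribˡ-∨ ⟩
      ¬¬ x · ¬ x ∨ ¬¬ x · x   ≤⟨ ∨-least (≤-trans (modus-ponens (¬ x) 𝟘) 𝟘≤x)
                                          (≤-trans (≤-reflexive (·≡∧ (¬¬ x) x)) x∧y≤y) ⟩
      x                       ∎)
    x≤¬¬x

  ¬-injective : ∀ {x y} → ¬ x ≡ ¬ y → x ≡ y
  ¬-injective {x} {y} ¬x≡¬y = trans (sym ¬¬x≡x) (trans (cong ¬_ ¬x≡¬y) ¬¬x≡x)

  ∧≤⇒≤⇾ : ∀ {x y z} → x ∧ y ≤ z → x ≤ y ⇾ z
  ∧≤⇒≤⇾ {x} {y} {z} = ·≤⇒≤⇾ ∘ subst (_≤ z) (sym (·≡∧ x y))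

  ≤⇾⇒∧≤ : ∀ {x y z} → x ≤ y ⇾ z → x ∧ y ≤ z
  ≤⇾⇒∧≤ {x} {y} {z} = subst (_≤ z) (·≡∧ x y) ∘ ≤⇾⇒·≤

  x∧¬x≤𝟘 : ∀ {x} → x ∧ ¬ x ≤ 𝟘
  x∧¬x≤𝟘 = ≤⇾⇒∧≤ x≤¬¬x

  ∧¬≤𝟘⇒≤ : ∀ {x y} → x ∧ ¬ y ≤ 𝟘 → x ≤ y
  ∧¬≤𝟘⇒≤ x∧¬y≤𝟘 = ≤-trans (∧≤⇒≤⇾ x∧¬y≤𝟘) (≤-reflexive ¬¬x≡x)

  infixr 5 _⇔_
  _⇔_ : Carrier → Carrier → Carrier
  x ⇔ y = (x ⇾ y) ∧ (y ⇾ x)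

  ⇒≡⇔ : ∀ {x y} → x ⇒ y ≡ x ⇔ y
  ⇒≡⇔ {x} {y} = cong (λ z → (x ⇾ y) ∧ (y ⇾ z)) ¬¬x≡x

  ¬x∧x≤𝟘 : ∀ {x} → ¬ x ∧ x ≤ 𝟘
  ¬x∧x≤𝟘 {x} = ≤-trans (≤-reflexive (∧-comm (¬ x) x)) x∧¬x≤𝟘

  ∧≤𝟘-cases : ∀ {x z} → z ∧ x ≤ 𝟘 → z ∧ ¬ x ≤ 𝟘 → z ≤ 𝟘
  ∧≤𝟘-cases z∧x≤𝟘 z∧¬x≤𝟘 = ≤-trans (∧-greatest (∧≤⇒≤⇾ z∧x≤𝟘) (∧≤⇒≤⇾ z∧¬x≤𝟘)) x∧¬x≤𝟘

  ∧¬≤⇒¬≤⇾ : ∀ {u v w} → u ∧ ¬ v ≤ w → ¬ w ≤ u ⇾ v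
  ∧¬≤⇒¬≤⇾ {u} {v} {w} u∧¬v≤w = ∧≤⇒≤⇾ (∧¬≤𝟘⇒≤ (begin
      (¬ w ∧ u) ∧ ¬ v  ≡⟨ ∧-assoc (¬ w) u (¬ v) ⟩
      ¬ w ∧ (u ∧ ¬ v)  ≤⟨ ∧-mono ≤-refl u∧¬v≤w ⟩
      ¬ w ∧ w          ≤⟨ ¬x∧x≤𝟘 ⟩
      𝟘                ∎))

  [x⇾y]∧x≤y : ∀ {x y} → (x ⇾ y) ∧ x ≤ y
  [x⇾y]∧x≤y = ≤⇾⇒∧≤ ≤-refl

  [x⇾y]∧¬y≤¬x : ∀ {x y} → (x ⇾ y) ∧ ¬ y ≤ ¬ x
  [x⇾y]∧¬y≤¬x {x} {y} = ∧≤⇒≤⇾ (begin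
      ((x ⇾ y) ∧ ¬ y) ∧ x  ≡⟨ ∧.xy∙z≈xz∙y (x ⇾ y) (¬ y) x ⟩
      ((x ⇾ y) ∧ x) ∧ ¬ y  ≤⟨ ∧-mono [x⇾y]∧x≤y ≤-refl ⟩
      y ∧ ¬ y              ≤⟨ x∧¬x≤𝟘 ⟩
      𝟘                    ∎)

  ⇔≡¬[⇔¬] : ∀ {x y} → x ⇔ y ≡ ¬ (x ⇔ ¬ y)
  ⇔≡¬[⇔¬] {x} {y} = ≤-antisym (∧≤⇒≤⇾ (∧≤𝟘-cases {x} z∧x≤𝟘 z∧¬x≤𝟘))
    (∧-greatest (∧¬≤⇒¬≤⇾ x∧¬y≤x⇔¬y) (∧¬≤⇒¬≤⇾ y∧¬x≤x⇔¬y))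
    where
    z = (x ⇔ y) ∧ (x ⇔ ¬ y)
    z∧x≤𝟘 : z ∧ x ≤ 𝟘
    z∧x≤𝟘 = begin
      z ∧ x                              ≤⟨ ∧-greatest (∧-mono (≤-trans x∧y≤x x∧y≤x) ≤-refl)
                                                       (∧-mono (≤-trans x∧y≤y x∧y≤x) ≤-refl) ⟩
      ((x ⇾ y) ∧ x) ∧ ((x ⇾ ¬ y) ∧ x)    ≤⟨ ∧-mono [x⇾y]∧x≤y [x⇾y]∧x≤y ⟩
      y ∧ ¬ y                            ≤⟨ x∧¬x≤𝟘 ⟩
      𝟘                                  ∎
    z∧¬x≤𝟘 : z ∧ ¬ x ≤ 𝟘
    z∧¬x≤𝟘 = begin
      z ∧ ¬ x                               ≤⟨ ∧-greatest (∧-mono (≤-trans x∧y≤x x∧y≤y) ≤-refl)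
                                                          (∧-mono (≤-trans x∧y≤y x∧y≤y) ≤-refl) ⟩
      ((y ⇾ x) ∧ ¬ x) ∧ ((¬ y ⇾ x) ∧ ¬ x)   ≤⟨ ∧-mono [x⇾y]∧¬y≤¬x [x⇾y]∧¬y≤¬x ⟩
      ¬ y ∧ ¬¬ y                            ≤⟨ x∧¬x≤𝟘 ⟩
      𝟘                                     ∎
    x∧¬y≤x⇔¬y : x ∧ ¬ y ≤ x ⇔ ¬ y
    x∧¬y≤x⇔¬y = ∧-greatest (∧≤⇒≤⇾ (≤-trans x∧y≤x x∧y≤y)) (∧≤⇒≤⇾ (≤-trans x∧y≤x x∧y≤x))
    y∧¬x≤x⇔¬y : y ∧ ¬ x ≤ x ⇔ ¬ y
    y∧¬x≤x⇔¬y = ∧-greatest (∧≤⇒≤⇾ (≤-trans (∧-mono x∧y≤y ≤-refl) (≤-trans ¬x∧x≤𝟘 𝟘≤x)))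
                           (∧≤⇒≤⇾ (≤-trans (∧-mono x∧y≤x ≤-refl) (≤-trans x∧¬x≤𝟘 𝟘≤x)))

  Id₃ᴬ-holds : Id₃ᴬ
  Id₃ᴬ-holds x y = begin-equality
      ¬¬ (x ⇒ y)    ≡⟨ ¬¬x≡x ⟩
      x ⇒ y         ≡⟨ ⇒≡⇔ ⟩
      x ⇔ y         ≡⟨ ⇔≡¬[⇔¬] ⟩
      ¬ (x ⇔ ¬ y)   ≡⟨ cong ¬_ ⇒≡⇔ ⟨
      ¬ (x ⇒ ¬ y)   ∎

infixr 5 _⇒ᵗ_
_⇒ᵗ_ : Term → Term → Term
s ⇒ᵗ t = (s ⇾ᵗ t) ∧ᵗ (t ⇾ᵗ (¬ᵗ (¬ᵗ s)))

-- Its negation ¬¬(x ⇒ y) ≈ ¬(x ⇒ ¬y) is the identity Id₃.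
connexiveEquation : Equation
connexiveEquation = ¬ᵗ (var 0 ⇒ᵗ var 1) , var 0 ⇒ᵗ ¬ᵗ var 1

connexiveVariety : Variety
connexiveVariety e = e ≡ negEq connexiveEquation

module _ (A : FLe) where
  open ConnexiveIdentities A

  ∈connexiveVariety↔Id₃ᴬ : (A ∈ connexiveVariety) ↔ Id₃ᴬ
  ∈connexiveVariety↔Id₃ᴬ = (λ A∈ x y → A∈ _ refl (valuation₂ x y)) , Id₃ᴬ⇒∈
    where
    Id₃ᴬ⇒∈ : Id₃ᴬ → A ∈ connexiveVariety
    Id₃ᴬ⇒∈ id₃ _ refl ρ = id₃ (ρ 0) (ρ 1)

BA⊨connexiveEquation : BA⊨ connexiveEquation
BA⊨connexiveEquation A ba ρ = ¬-injective (Id₃ᴬ-holds (ρ 0) (ρ 1))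
  where open BooleanAlgebra A ba

connexiveVariety-glivenko : GlivenkoBA connexiveVariety
connexiveVariety-glivenko e = BA⊨⇒⊨negEq , ⊨negEq⇒BA⊨
  where
  BA⊨⇒⊨negEq : BA⊨ e → connexiveVariety ⊨ᵛ negEq e
  BA⊨⇒⊨negEq valid A A∈ = glivenko {e} valid
    where
    id₃ = proj₁ (∈connexiveVariety↔Id₃ᴬ A) A∈
    open RegularAlgebra A (Id₃Consequences.glivenkoAxioms A id₃)
  ⊨negEq⇒BA⊨ : connexiveVariety ⊨ᵛ negEq e → BA⊨ e
  ⊨negEq⇒BA⊨ ⊨¬e A ba ρ = ¬-injective (⊨¬e A (proj₂ (∈connexiveVariety↔Id₃ᴬ A) Id₃ᴬ-holds) ρ)
    where open BooleanAlgebra A ba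

glivenkoBA⇒Id₃ : ∀ {W} → GlivenkoBA W → Id₃ W
glivenkoBA⇒Id₃ glivenkoW A A∈W x y =
  proj₁ (glivenkoW connexiveEquation) BA⊨connexiveEquation A A∈W (valuation₂ x y)

module _ (V : Variety) where
  open ConnexiveIdentities

  PC↔Id₃ : PC V ↔ Id₃ V
  PC↔Id₃ = ↔-pointwise {V} {λ A → ProtoConnexive A (cimp A)} {Id₃ᴬ} protoConnexive↔Id₃ᴬ

  Id₁↔Id₃ : Id₁ V ↔ Id₃ V
  Id₁↔Id₃ = ↔-pointwise {V} {Id₁ᴬ} {Id₃ᴬ} Id₁ᴬ↔Id₃ᴬ

  Id₂↔Id₃ : Id₂ V ↔ Id₃ V
  Id₂↔Id₃ = ↔-pointwise {V} {Id₂ᴬ} {Id₃ᴬ} Id₂ᴬ↔Id₃ᴬ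

  ⊆G↔Id₃ : (V ⊆G) ↔ Id₃ V
  ⊆G↔Id₃ =
    (λ (W , glivenkoW , V⊆W) A A∈V → glivenkoBA⇒Id₃ glivenkoW A (V⊆W A A∈V)) ,
    (λ id₃ → connexiveVariety , connexiveVariety-glivenko ,
             λ A A∈V → proj₂ (∈connexiveVariety↔Id₃ᴬ A) (id₃ A A∈V))

theorem3p17 : (∀ (V : Variety) →
    (PC V ↔ (V ⊆G)) × (PC V ↔ Id₁ V) × (PC V ↔ Id₂ V) × (PC V ↔ Id₃ V))
  × (∀ (W : Variety) → GlivenkoBA W → PC W)
theorem3p17 =
  (λ V → ↔-trans (PC↔Id₃ V) (↔-sym (⊆G↔Id₃ V)) ,
         ↔-trans (PC↔Id₃ V) (↔-sym (Id₁↔Id₃ V)) ,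
         ↔-trans (PC↔Id₃ V) (↔-sym (Id₂↔Id₃ V)) ,
         PC↔Id₃ V) ,
  (λ W glivenkoW → proj₂ (PC↔Id₃ W) (glivenkoBA⇒Id₃ glivenkoW))
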